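{- Let $k$ and $m$ be integers with $1<m<k$ and $m$ odd. Let $\mathbf{u}$ and $\mathbf{w}$ be distinct vertices of $\Omega_{2k}$ with $\mathrm{wt}(\mathbf{u})=\mathrm{wt}(\mathbf{w})=m$. Then there exists $\mathbf{y}\in V(\Omega_{2k})$ with $\mathrm{wt}(\mathbf{y})=k-1$ that is adjacent to $\mathbf{u}$ but not adjacent to $\mathbf{w}$.
   Context: The orthogonality graph $\Omega_{2k}$ has vertex set $\mathbb{Z}_2^{2k}$ (bitstrings of length $2k$), with two vertices adjacent if and only if they differ in exactly $k$ positions. $\mathrm{wt}(\mathbf{x})$ is the number of 1s in the bitstring $\mathbf{x}$. -}

module Defs where

open import Data.Nat using (ℕ; zero; suc; _+_; _*_)
open import Data.Bool using (Bool; true; false; _xor_)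
open import Data.Vec using (Vec; []; _∷_; zipWith)
open import Relation.Binary.PropositionalEquality using (_≡_)

Vertex : ℕ → Set
Vertex k = Vec Bool (2 * k)

wt : ∀ {n} → Vec Bool n → ℕ
wt [] = 0
wt (true ∷ xs) = suc (wt xs)
wt (false ∷ xs) = wt xs

dist : ∀ {n} → Vec Bool n → Vec Bool n → ℕ
dist x y = wt (zipWith _xor_ x y)

Adj : (k : ℕ) → Vertex k → Vertex k → Set
Adj k x y = dist x y ≡ k

-- Classify the 2k coordinates by the pair (uᵢ, wᵢ): s of type TT, p of type TF, p of type FT
-- (u and w have the same weight) and q of type FF, where p > 0 because u ≠ w. Write m = 2h + 1.
-- Let y select a, b, c, d coordinates of the four types. If a + b = h and c + d = k - 1 - h, then
-- wt y = k - 1 and dist y u = (m - h) + (k - 1 - h) = k, while dist y w - dist y u = 2(b - c).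
-- So it suffices to choose the counts with b ≠ c: when p ≤ h take b = 0 and c = p, otherwise
-- b = h and c = h + 1; the bound h < k - 1 - h leaves room among the FF coordinates.
module Submission where

open import Data.Bool using (Bool; true; false; _∧_)
open import Data.Bool.Properties using () renaming (_≟_ to _≟ᵇ_)
import Data.List.Base as List
open import Data.Nat using (ℕ; suc; _+_; _*_; _∸_; _/_; _≤_; _<_; z≤n; s≤s; s≤s⁻¹)
open import Data.Nat.DivMod using (_%_; m≡m%n+[m/n]*n)
open import Data.Nat.Properties
open import Data.Nat.Tactic.RingSolver using (solve)
open import Data.Product using (Σ; ∃; _×_; _,_)
open import Data.Vec using (Vec; []; _∷_; zipWith)
open import Relation.Binary.PropositionalEquality
  using (_≡_; _≢_; refl; sym; trans; cong; cong₂; subst; module ≡-Reasoning)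
open import Relation.Nullary using (¬_; does; yes; no)

open import Defs

occurrences : ∀ {n} → Bool → Bool → Vec Bool n → Vec Bool n → ℕ
occurrences x y u w = wt (zipWith (λ uᵢ wᵢ → does (uᵢ ≟ᵇ x) ∧ does (wᵢ ≟ᵇ y)) u w)

wt-fst : ∀ {n} (u w : Vec Bool n) →
         wt u ≡ occurrences true true u w + occurrences true false u w
wt-fst [] [] = refl
wt-fst (true ∷ u) (true ∷ w) = cong suc (wt-fst u w)
wt-fst (true ∷ u) (false ∷ w) = trans (cong suc (wt-fst u w)) (sym (+-suc _ _))
wt-fst (false ∷ u) (_ ∷ w) = wt-fst u w

wt-snd : ∀ {n} (u w : Vec Bool n) →
         wt w ≡ occurrences true true u w + occurrences false true u w
wt-snd [] [] = refl
wt-snd (true ∷ u) (true ∷ w) = cong suc (wt-snd u w)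
wt-snd (false ∷ u) (true ∷ w) = trans (cong suc (wt-snd u w)) (sym (+-suc _ _))
wt-snd (true ∷ u) (false ∷ w) = wt-snd u w
wt-snd (false ∷ u) (false ∷ w) = wt-snd u w

occurrences-total : ∀ {n} (u w : Vec Bool n) →
  occurrences true true u w + (occurrences true false u w +
    (occurrences false true u w + occurrences false false u w)) ≡ n
occurrences-total [] [] = refl
occurrences-total (true ∷ u) (true ∷ w) = cong suc (occurrences-total u w)
occurrences-total (true ∷ u) (false ∷ w) =
  trans (+-suc _ _) (cong suc (occurrences-total u w))
occurrences-total (false ∷ u) (true ∷ w) =
  trans (cong (tt +_) (+-suc tf _)) (trans (+-suc tt _) (cong suc (occurrences-total u w)))
  where tt = occurrences true true u w; tf = occurrences true false u w
occurrences-total (false ∷ u) (false ∷ w) =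
  trans (cong (λ x → tt + (tf + x)) (+-suc ft _))
    (trans (cong (tt +_) (+-suc tf _)) (trans (+-suc tt _) (cong suc (occurrences-total u w))))
  where
  tt = occurrences true true u w; tf = occurrences true false u w
  ft = occurrences false true u w

no-disagreement⇒≡ : ∀ {n} (u w : Vec Bool n) →
  occurrences true false u w ≡ 0 → occurrences false true u w ≡ 0 → u ≡ w
no-disagreement⇒≡ [] [] _ _ = refl
no-disagreement⇒≡ (true ∷ u) (true ∷ w) tf ft = cong (true ∷_) (no-disagreement⇒≡ u w tf ft)
no-disagreement⇒≡ (false ∷ u) (false ∷ w) tf ft = cong (false ∷_) (no-disagreement⇒≡ u w tf ft)

realise : ∀ {n} (u w : Vec Bool n) (a a′ b b′ c c′ d : ℕ) →
  a + a′ ≡ occurrences true true u w → b + b′ ≡ occurrences true false u w →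
  c + c′ ≡ occurrences false true u w → d ≤ occurrences false false u w →
  ∃ λ y → wt y ≡ (a + b) + (c + d) × dist y u ≡ (a′ + b′) + (c + d)
                                   × dist y w ≡ (a′ + b) + (c′ + d)
realise [] [] 0 0 0 0 0 0 0 refl refl refl z≤n = [] , refl , refl , refl
realise [] [] (suc _) _ _ _ _ _ _ () _ _ _
realise [] [] 0 (suc _) _ _ _ _ _ () _ _ _
realise [] [] _ _ (suc _) _ _ _ _ _ () _ _
realise [] [] _ _ 0 (suc _) _ _ _ _ () _ _
realise [] [] _ _ _ _ (suc _) _ _ _ _ () _
realise [] [] _ _ _ _ 0 (suc _) _ _ _ () _
realise (true ∷ u) (true ∷ w) (suc a) a′ b b′ c c′ d ea eb ec ed
  with y , wt-y , du , dw ← realise u w a a′ b b′ c c′ d (suc-injective ea) eb ec ed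
  = true ∷ y , cong suc wt-y , du , dw
realise (true ∷ u) (true ∷ w) 0 (suc a′) b b′ c c′ d ea eb ec ed
  with y , wt-y , du , dw ← realise u w 0 a′ b b′ c c′ d (suc-injective ea) eb ec ed
  = false ∷ y , wt-y , cong suc du , cong suc dw
realise (true ∷ u) (false ∷ w) a a′ (suc b) b′ c c′ d ea eb ec ed
  rewrite +-suc a b | +-suc a′ b
  with y , wt-y , du , dw ← realise u w a a′ b b′ c c′ d ea (suc-injective eb) ec ed
  = true ∷ y , cong suc wt-y , du , cong suc dw
realise (true ∷ u) (false ∷ w) a a′ 0 (suc b′) c c′ d ea eb ec ed
  rewrite +-suc a′ b′
  with y , wt-y , du , dw ← realise u w a a′ 0 b′ c c′ d ea (suc-injective eb) ec ed
  = false ∷ y , wt-y , cong suc du , dw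
realise (false ∷ u) (true ∷ w) a a′ b b′ (suc c) c′ d ea eb ec ed
  rewrite +-suc (a + b) (c + d) | +-suc (a′ + b′) (c + d)
  with y , wt-y , du , dw ← realise u w a a′ b b′ c c′ d ea eb (suc-injective ec) ed
  = true ∷ y , cong suc wt-y , cong suc du , dw
realise (false ∷ u) (true ∷ w) a a′ b b′ 0 (suc c′) d ea eb ec ed
  rewrite +-suc (a′ + b) (c′ + d)
  with y , wt-y , du , dw ← realise u w a a′ b b′ 0 c′ d ea eb (suc-injective ec) ed
  = false ∷ y , wt-y , du , cong suc dw
realise (false ∷ u) (false ∷ w) a a′ b b′ c c′ (suc d) ea eb ec (s≤s ed)
  rewrite +-suc c d | +-suc (a + b) (c + d) | +-suc (a′ + b′) (c + d)
        | +-suc c′ d | +-suc (a′ + b) (c′ + d)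
  with y , wt-y , du , dw ← realise u w a a′ b b′ c c′ d ea eb ec ed
  = true ∷ y , cong suc wt-y , cong suc du , cong suc dw
realise (false ∷ u) (false ∷ w) a a′ b b′ c c′ 0 ea eb ec z≤n
  with y , wt-y , du , dw ← realise u w a a′ b b′ c c′ 0 ea eb ec z≤n
  = false ∷ y , wt-y , du , dw

-- a, b, c, d coordinates of types TT, TF, FT, FF are selected; a′, b′, c′ of the first three are not.
record Selection (s p q h e : ℕ) : Set where
  field
    a a′ b b′ c c′ d : ℕ
    a+a′≡s : a + a′ ≡ s
    b+b′≡p : b + b′ ≡ p
    c+c′≡p : c + c′ ≡ p
    d≤q : d ≤ q
    a+b≡h : a + b ≡ h
    c+d≡e : c + d ≡ e
    b≢c : b ≢ c

m+n≡o+p⇒m≤p⇒o≤n : ∀ {m n o p} → m + n ≡ o + p → m ≤ p → o ≤ n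
m+n≡o+p⇒m≤p⇒o≤n {m} {n} {o} {p} eq m≤p = +-cancelʳ-≤ m o n (begin
  o + m ≤⟨ +-monoʳ-≤ o m≤p ⟩
  o + p ≡⟨ sym eq ⟩
  m + n ≡⟨ +-comm m n ⟩
  n + m ∎)
  where open ≤-Reasoning

selection-p≤h : ∀ {s q} p t d → 0 < p →
  s + p ≡ suc ((p + t) + (p + t)) → p + q ≡ suc ((p + d) + (p + d)) →
  Selection s p q (p + t) (p + d)
selection-p≤h {s} {q} p t d p>0 sp pq = record
  { a = p + t ; a′ = suc t ; b = 0 ; b′ = p ; c = p ; c′ = 0 ; d = d
  ; a+a′≡s = +-cancelʳ-≡ p (p + t + suc t) s (trans rearrange (sym sp))
  ; b+b′≡p = refl
  ; c+c′≡p = +-identityʳ p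
  ; d≤q = subst (d ≤_) (sym q≡) (m≤n⇒m≤1+n (m≤m+n d (p + d)))
  ; a+b≡h = +-identityʳ (p + t)
  ; c+d≡e = refl
  ; b≢c = <⇒≢ p>0
  }
  where
  rearrange : p + t + suc t + p ≡ suc ((p + t) + (p + t))
  rearrange = solve (p List.∷ t List.∷ List.[])
  q≡ : q ≡ suc (d + (p + d))
  q≡ = +-cancelˡ-≡ p q (suc (d + (p + d))) (trans pq (solve (p List.∷ d List.∷ List.[])))

selection-h<p : ∀ {s q} h t d →
  s + (suc h + t) ≡ suc (h + h) → (suc h + t) + q ≡ suc ((suc h + d) + (suc h + d)) →
  Selection s (suc h + t) q h (suc h + d)
selection-h<p {s} {q} h t d sp pq = record
  { a = 0 ; a′ = s ; b = h ; b′ = suc t ; c = suc h ; c′ = t ; d = d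
  ; a+a′≡s = refl
  ; b+b′≡p = +-suc h t
  ; c+c′≡p = refl
  ; d≤q = m+n≡o+p⇒m≤p⇒o≤n t+q≡ t≤
  ; a+b≡h = refl
  ; c+d≡e = refl
  ; b≢c = <⇒≢ (n<1+n h)
  }
  where
  t+q≡ : t + q ≡ d + suc (suc h + d)
  t+q≡ = +-cancelˡ-≡ (suc h) (t + q) (d + suc (suc h + d))
    (trans (sym (+-assoc (suc h) t q)) (trans pq (solve (h List.∷ d List.∷ List.[]))))
  t≤ : t ≤ suc (suc h + d)
  t≤ = ≤-trans (+-cancelˡ-≤ h t h (s≤s⁻¹ (m+n≤o⇒n≤o s (≤-reflexive sp))))
         (m≤n⇒m≤1+n (m≤n⇒m≤1+n (m≤m+n h d)))

choose : ∀ {s p q h e} → 0 < p → h < e →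
  s + p ≡ suc (h + h) → p + q ≡ suc (e + e) → Selection s p q h e
choose {p = p} {h = h} p>0 h<e sp pq with p ≤? h
... | yes p≤h
  with t , refl ← m≤n⇒∃[o]m+o≡n p≤h
  with d , refl ← m≤n⇒∃[o]m+o≡n (≤-trans p≤h (<⇒≤ h<e))
  = selection-p≤h p t d p>0 sp pq
... | no p≰h
  with t , refl ← m≤n⇒∃[o]m+o≡n (≰⇒> p≰h)
  with d , refl ← m≤n⇒∃[o]m+o≡n h<e
  = selection-h<p h t d sp pq

outside-size : ∀ {s p q h r} → s + p ≡ suc (h + h) →
  s + (p + (p + q)) ≡ 2 * (suc (suc (h + h)) + r) → p + q ≡ suc ((suc h + r) + (suc h + r))
outside-size {s} {p} {q} {h} {r} sp total = +-cancelˡ-≡ (suc (h + h)) (p + q) _ (begin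
  suc (h + h) + (p + q)               ≡⟨ cong (_+ (p + q)) (sym sp) ⟩
  s + p + (p + q)                     ≡⟨ +-assoc s p (p + q) ⟩
  s + (p + (p + q))                   ≡⟨ total ⟩
  2 * (suc (suc (h + h)) + r)         ≡⟨ solve (h List.∷ r List.∷ List.[]) ⟩
  suc (h + h) + suc ((suc h + r) + (suc h + r)) ∎)
  where open ≡-Reasoning

unselected-inside : ∀ {a a′ b b′ h} →
  (a + a′) + (b + b′) ≡ suc (h + h) → a + b ≡ h → a′ + b′ ≡ suc h
unselected-inside {a} {a′} {b} {b′} total refl =
  +-cancelˡ-≡ (a + b) (a′ + b′) (suc (a + b)) (begin
    a + b + (a′ + b′)     ≡⟨ solve (a List.∷ a′ List.∷ b List.∷ b′ List.∷ List.[]) ⟩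
    a + a′ + (b + b′)     ≡⟨ total ⟩
    suc (a + b + (a + b)) ≡⟨ sym (+-suc (a + b) (a + b)) ⟩
    a + b + suc (a + b)   ∎)
  where open ≡-Reasoning

balanced-swap⇒≡ : ∀ {x b b′ c c′ d} → b + b′ ≡ c + c′ →
  x + b + (c′ + d) ≡ x + b′ + (c + d) → b ≡ c
balanced-swap⇒≡ {x} {b} {b′} {c} {c′} {d} balance eq = *-cancelˡ-≡ b c 2
  (+-cancelʳ-≡ (b′ + c′) (2 * b) (2 * c) (begin
    2 * b + (b′ + c′)     ≡⟨ solve (b List.∷ b′ List.∷ c′ List.∷ List.[]) ⟩
    (b + c′) + (b + b′)   ≡⟨ cong₂ _+_ swapped balance ⟩
    (b′ + c) + (c + c′)   ≡⟨ solve (b′ List.∷ c List.∷ c′ List.∷ List.[]) ⟩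
    2 * c + (b′ + c′)     ∎))
  where
  open ≡-Reasoning
  swapped : b + c′ ≡ b′ + c
  swapped = +-cancelˡ-≡ (x + d) (b + c′) (b′ + c) (begin
    x + d + (b + c′)   ≡⟨ solve (x List.∷ b List.∷ c′ List.∷ d List.∷ List.[]) ⟩
    x + b + (c′ + d)   ≡⟨ eq ⟩
    x + b′ + (c + d)   ≡⟨ solve (x List.∷ b′ List.∷ c List.∷ d List.∷ List.[]) ⟩
    x + d + (b′ + c)   ∎)

distinguishing-vertex : ∀ h r (u w : Vertex (suc (suc (h + h)) + r)) → u ≢ w →
  wt u ≡ suc (h + h) → wt w ≡ suc (h + h) →
  Σ (Vertex (suc (suc (h + h)) + r)) λ y →
    wt y ≡ suc (h + h) + r × Adj _ y u × ¬ Adj _ y w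
distinguishing-vertex h r u w u≢w wt-u wt-w =
  let y , wt-y , dist-y-u , dist-y-w =
        realise u w a a′ b b′ c c′ d a+a′≡s b+b′≡p (trans c+c′≡p (sym FT≡p)) d≤q
      dist-y-u′ = trans dist-y-u
                    (trans (cong₂ _+_ a′+b′≡1+h c+d≡e) (cong suc h+[1+h+r]≡1+2h+r))
  in  y , trans wt-y (trans (cong₂ _+_ a+b≡h c+d≡e) h+[1+h+r]≡1+2h+r) , dist-y-u′
      , λ adj → b≢c (balanced-swap⇒≡ {x = a′} {d = d} (trans b+b′≡p (sym c+c′≡p))
                       (trans (sym dist-y-w) (trans adj (trans (sym dist-y-u′) dist-y-u))))
  where
  s = occurrences true true u w
  p = occurrences true false u w
  q = occurrences false false u w
  s+p≡m : s + p ≡ suc (h + h)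
  s+p≡m = trans (sym (wt-fst u w)) wt-u
  FT≡p : occurrences false true u w ≡ p
  FT≡p = +-cancelˡ-≡ s _ p (trans (trans (sym (wt-snd u w)) wt-w) (sym s+p≡m))
  p>0 : 0 < p
  p>0 = n≢0⇒n>0 λ p≡0 → u≢w (no-disagreement⇒≡ u w p≡0 (trans FT≡p p≡0))
  p+q≡ : p + q ≡ suc ((suc h + r) + (suc h + r))
  p+q≡ = outside-size {s} {p} {q} {h} {r} s+p≡m
    (subst (λ n → s + (p + (n + q)) ≡ 2 * (suc (suc (h + h)) + r)) FT≡p (occurrences-total u w))
  open Selection (choose p>0 (s≤s (m≤m+n h r)) s+p≡m p+q≡)
  a′+b′≡1+h : a′ + b′ ≡ suc h
  a′+b′≡1+h = unselected-inside {a} {a′} {b} {b′} (trans (cong₂ _+_ a+a′≡s b+b′≡p) s+p≡m) a+b≡h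
  h+[1+h+r]≡1+2h+r : h + (suc h + r) ≡ suc (h + h) + r
  h+[1+h+r]≡1+2h+r = solve (h List.∷ r List.∷ List.[])

odd⇒≡1+2h : ∀ m → m % 2 ≡ 1 → ∃ λ h → m ≡ suc (h + h)
odd⇒≡1+2h m m-odd = m / 2 , (begin
  m                   ≡⟨ m≡m%n+[m/n]*n m 2 ⟩
  m % 2 + m / 2 * 2   ≡⟨ cong (_+ m / 2 * 2) m-odd ⟩
  suc (m / 2 * 2)     ≡⟨ cong suc (trans (*-comm (m / 2) 2) (cong (m / 2 +_) (+-identityʳ (m / 2)))) ⟩
  suc (m / 2 + m / 2) ∎)
  where open ≡-Reasoning

lemma7 : (k m : ℕ) → 1 < m → m < k → m % 2 ≡ 1 →
    (u w : Vertex k) → u ≢ w → wt u ≡ m → wt w ≡ m →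
    Σ (Vertex k) (λ y → (wt y ≡ k ∸ 1) × Adj k y u × ¬ Adj k y w)
lemma7 k m _ m<k m-odd u w u≢w wt-u wt-w
  with r , refl ← m≤n⇒∃[o]m+o≡n m<k
  with h , refl ← odd⇒≡1+2h m m-odd
  = distinguishing-vertex h r u w u≢w wt-u wt-w
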